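{- Let $G$ be a dynamic graph that initially has $m$ edges and undergoes batches of updates $U^{(1)},U^{(2)},\ldots$, each update being an edge insertion, an edge deletion, or a vertex split. Then the total encoding size satisfies $\sum_t \mathrm{Enc}(U^{(t)}) = \tilde{O}\left(m+\sum_t |U^{(t)}|\right)$.
   Context: Updates: an edge insertion adds an edge $e=(u,v)$; an edge deletion removes an existing edge; a vertex split replaces a vertex $v$ by two vertices $v_1,v_2$, with each edge incident to $v$ reassigned to exactly one of $v_1,v_2$. Encoding sizes: an edge insertion or deletion has encoding size $\tilde{O}(1)$; a vertex split is encoded by listing the edges moved to whichever of $v_1,v_2$ has smaller degree, so its encoding size is $\tilde{O}(\min\{\deg(v_1),\deg(v_2)\})$ (degrees after the split). For a batch $U^{(t)}$, $|U^{(t)}|$ is the number of updates in it and $\mathrm{Enc}(U^{(t)})$ is the sum of encoding sizes of its updates. $\tilde{O}(\cdot)$ hides polylogarithmic factors. -}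

module Defs where

open import Data.Nat using (ℕ; _+_; _≡ᵇ_; _∸_; _⊓_)
open import Data.Bool using (if_then_else_)
open import Data.Product using (_×_; _,_)
open import Data.Sum using (_⊎_)
open import Data.List using (List; []; _∷_; _++_; map; length; concat)
open import Data.Nat.ListAction using (sum)
open import Data.List.Relation.Unary.All using (All)
open import Data.List.Relation.Binary.Permutation.Propositional using (_↭_)
open import Relation.Binary.PropositionalEquality using (_≡_)
open import Relation.Nullary using (¬_)

-- Vertices are natural-number labels; an edge is an (unordered, conceptually)
-- pair of endpoints; a graph is a finite multiset (list up to permutation) of
-- edges.  Multi-edges and self-loops are allowed.
Vertex : Set
Vertex = ℕ

Edge : Set
Edge = Vertex × Vertex

Graph : Set
Graph = List Edge

numEdges : Graph → ℕ
numEdges = length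

incident : Vertex → Edge → Set
incident v (a , b) = (a ≡ v) ⊎ (b ≡ v)

-- number of endpoints of e equal to v (a self-loop counts twice)
endpts : Vertex → Edge → ℕ
endpts v (a , b) = (if a ≡ᵇ v then 1 else 0) + (if b ≡ᵇ v then 1 else 0)

deg : Vertex → Graph → ℕ
deg v G = sum (map (endpts v) G)

rename : Vertex → Vertex → Edge → Edge
rename v w (a , b) = (if a ≡ᵇ v then w else a) , (if b ≡ᵇ v then w else b)

-- A vertex split `split v v₂ B` replaces v by v₁ := v (keeping its
-- label) and a fresh vertex v₂; B is the list of edges incident to v that are
-- reassigned to v₂ (all other edges incident to v stay at v₁).
data Update : Set where
  insE  : Edge → Update
  delE  : Edge → Update
  split : Vertex → Vertex → List Edge → Update

data Step : Graph → Update → Graph → Set where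
  ins   : ∀ {G} (e : Edge) → Step G (insE e) (e ∷ G)
  del   : ∀ {G H} (e : Edge) → G ↭ (e ∷ H) → Step G (delE e) H
  split : ∀ {G} (v v₂ : Vertex) (A B C : List Edge) →
          ¬ (v₂ ≡ v) →
          All (λ e → ¬ incident v₂ e) G →
          G ↭ (A ++ B ++ C) →
          All (incident v) A →
          All (incident v) B →
          All (λ e → ¬ incident v e) C →
          Step G (split v v₂ B) (A ++ map (rename v v₂) B ++ C)

-- Edge insertions/deletions: 1 (i.e. Õ(1)).
-- Vertex split: min{deg(v₁), deg(v₂)} measured after the split, where
-- deg(v₂) after = deg of v within B and deg(v₁) after = deg(v) − that.
enc : Graph → Update → ℕ
enc G (insE _) = 1
enc G (delE _) = 1
enc G (split v v₂ B) = (deg v G ∸ deg v B) ⊓ deg v B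

data Run : Graph → List Update → Set where
  []  : ∀ {G} → Run G []
  _∷_ : ∀ {G G' u us} → Step G u G' → Run G' us → Run G (u ∷ us)

encRun : ∀ {G us} → Run G us → ℕ
encRun [] = 0
encRun {G} {u ∷ _} (_ ∷ r) = enc G u + encRun r

-- Batches U⁽¹⁾, U⁽²⁾, … are lists of updates applied in order.
-- Σ_t Enc(U⁽ᵗ⁾) is the encoding size of the run of their concatenation.
Batches : Set
Batches = List (List Update)

totalUpdates : Batches → ℕ
totalUpdates Us = sum (map length Us)

-- Amortise against the potential Φ(G) = Σ_x Λ(deg_G x), where
-- Λ(d) = Σ_{i ≤ d} ⌊log₂ i⌋ ≈ d log d.  For a ≤ b,
-- Λ(a + b) − Λ(b) = Σ_{i ≤ a} ⌊log₂ (b + i)⌋ ≥ Σ_{i ≤ a} ⌊log₂ 2i⌋ = a + Λ(a),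
-- so splitting a vertex of degree a + b into degrees a and b releases at
-- least min(a, b), which pays for the encoding of the split.  Along a run of
-- N updates from a graph with m edges no graph has more than T = m + N edges,
-- so an insertion raises Φ by at most 2 ⌊log₂ 2T⌋, a deletion never raises it,
-- and initially Φ ≤ 2m ⌊log₂ 2T⌋.  Hence the total encoding size is at most
-- Φ(G₀) + N (1 + 2 ⌊log₂ 2T⌋) ≤ 3 T (1 + ⌊log₂ T⌋).

module Submission where

open import Defs
open import Data.Bool using (true; false; if_then_else_)
open import Data.List using (List; []; _∷_; _++_; map; length; concat; foldr)
open import Data.List.Properties using (length-++; map-++)
open import Data.List.Relation.Binary.Permutation.Propositional using (_↭_)
open import Data.List.Relation.Binary.Permutation.Propositional.Properties
  using (All-resp-↭; map⁺; ↭-length)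
open import Data.List.Relation.Unary.All using (All; []; _∷_)
open import Data.List.Relation.Unary.All.Properties using (++⁻ˡ; ++⁻ʳ)
open import Data.Nat using (ℕ; zero; suc; _+_; _*_; _^_; _⊓_; _⊔_; _≤_; _<_; z≤n; s≤s; _≡ᵇ_)
open import Data.Nat.ListAction using (sum)
open import Data.Nat.ListAction.Properties using (sum-++; sum-↭)
open import Data.Nat.Logarithm using (⌊log₂_⌋; ⌊log₂⌋-mono-≤; ⌊log₂[2*b]⌋≡1+⌊log₂b⌋)
open import Data.Nat.Properties
open import Algebra.Properties.CommutativeSemigroup +-commutativeSemigroup
  using (interchange; xy∙z≈xz∙y; x∙yz≈y∙xz)
open import Data.Nat.Tactic.RingSolver using (solve-∀)
open import Data.Product using (Σ; _,_)
open import Data.Sum using (inj₁; inj₂)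
open import Function using (_∘_)
open import Relation.Binary.PropositionalEquality
open import Relation.Nullary using (¬_; yes; no)
open import Relation.Nullary.Decidable using (dec-true; dec-false)

∑< : ℕ → (ℕ → ℕ) → ℕ
∑< zero    f = 0
∑< (suc n) f = ∑< n f + f n

syntax ∑< n (λ x → e) = ∑[ x < n ] e

∑<-zero : ∀ n → ∑[ x < n ] 0 ≡ 0
∑<-zero zero    = refl
∑<-zero (suc n) = trans (+-identityʳ _) (∑<-zero n)

∑<-mono-≤ : ∀ {f g} n → (∀ x → x < n → f x ≤ g x) → ∑< n f ≤ ∑< n g
∑<-mono-≤ zero    _   = z≤n
∑<-mono-≤ (suc n) f≤g =
  +-mono-≤ (∑<-mono-≤ n λ x x<n → f≤g x (m<n⇒m<1+n x<n)) (f≤g n ≤-refl)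

∑<-distrib-+ : ∀ f g n → ∑[ x < n ] (f x + g x) ≡ ∑< n f + ∑< n g
∑<-distrib-+ f g zero    = refl
∑<-distrib-+ f g (suc n) =
  trans (cong (_+ (f n + g n)) (∑<-distrib-+ f g n)) (interchange (∑< n f) (∑< n g) (f n) (g n))

∑<-distribʳ-* : ∀ f c n → ∑[ x < n ] (f x * c) ≡ ∑< n f * c
∑<-distribʳ-* f c zero    = refl
∑<-distribʳ-* f c (suc n) =
  trans (cong (_+ f n * c) (∑<-distribʳ-* f c n)) (sym (*-distribʳ-+ c (∑< n f) (f n)))

∑<-mono-except : ∀ {f g} n {w} → w < n → (∀ x → x < n → x ≢ w → f x ≤ g x) →
                 ∑< n f + g w ≤ ∑< n g + f w
∑<-mono-except {f} {g} (suc n) {w} w<1+n f≤g with n ≟ w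
... | yes refl = begin
  ∑< n f + f n + g n ≡⟨ xy∙z≈xz∙y (∑< n f) (f n) (g n) ⟩
  ∑< n f + g n + f n ≤⟨ +-monoˡ-≤ (f n) (+-monoˡ-≤ (g n) (∑<-mono-≤ n λ x x<n →
                          f≤g x (m<n⇒m<1+n x<n) (<⇒≢ x<n))) ⟩
  ∑< n g + g n + f n ∎
  where open ≤-Reasoning
... | no n≢w = begin
  ∑< n f + f n + g w ≡⟨ xy∙z≈xz∙y (∑< n f) (f n) (g w) ⟩
  ∑< n f + g w + f n ≤⟨ +-mono-≤ (∑<-mono-except n w<n λ x x<n → f≤g x (m<n⇒m<1+n x<n))
                                 (f≤g n ≤-refl n≢w) ⟩
  ∑< n g + f w + g n ≡⟨ xy∙z≈xz∙y (∑< n g) (f w) (g n) ⟩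
  ∑< n g + g n + f w ∎
  where
  open ≤-Reasoning
  w<n : w < n
  w<n = ≤∧≢⇒< (≤-pred w<1+n) (≢-sym n≢w)

∑<-mono-except-last : ∀ {f g} n {w} c → w < n → (∀ x → x < n → x ≢ w → f x ≤ g x) →
                      f n + f w + c ≤ g n + g w → ∑< (suc n) f + c ≤ ∑< (suc n) g
∑<-mono-except-last {f} {g} n {w} c w<n f≤g fnw≤gnw = +-cancelʳ-≤ (g w) _ _ (begin
  ∑< n f + f n + c + g w     ≡⟨ rearrange (∑< n f) (f n) c (g w) ⟩
  ∑< n f + g w + (f n + c)   ≤⟨ +-monoˡ-≤ (f n + c) (∑<-mono-except n w<n f≤g) ⟩
  ∑< n g + f w + (f n + c)   ≡⟨ rearrange′ (∑< n g) (f w) (f n) c ⟩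
  ∑< n g + (f n + f w + c)   ≤⟨ +-monoʳ-≤ (∑< n g) fnw≤gnw ⟩
  ∑< n g + (g n + g w)       ≡⟨ sym (+-assoc (∑< n g) (g n) (g w)) ⟩
  ∑< n g + g n + g w         ∎)
  where
  open ≤-Reasoning
  rearrange : ∀ s a c b → s + a + c + b ≡ s + b + (a + c)
  rearrange = solve-∀
  rearrange′ : ∀ s b a c → s + b + (a + c) ≡ s + (a + b + c)
  rearrange′ = solve-∀

∑<-mono-except₂ : ∀ {f g} n {v w} c → v ≢ w → v < n → w < n →
                  (∀ x → x < n → x ≢ v → x ≢ w → f x ≤ g x) →
                  f v + f w + c ≤ g v + g w → ∑< n f + c ≤ ∑< n g
∑<-mono-except₂ {f} {g} (suc n) {v} {w} c v≢w v<1+n w<1+n f≤g fvw≤gvw with n ≟ v | n ≟ w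
... | yes refl | _        =
  ∑<-mono-except-last n c (≤∧≢⇒< (≤-pred w<1+n) (≢-sym v≢w))
    (λ x x<n → f≤g x (m<n⇒m<1+n x<n) (<⇒≢ x<n)) fvw≤gvw
... | no _     | yes refl =
  ∑<-mono-except-last n c (≤∧≢⇒< (≤-pred v<1+n) v≢w)
    (λ x x<n x≢v → f≤g x (m<n⇒m<1+n x<n) x≢v (<⇒≢ x<n))
    (subst₂ _≤_ (cong (_+ c) (+-comm (f v) (f n))) (+-comm (g v) (g n)) fvw≤gvw)
... | no n≢v   | no n≢w   = begin
  ∑< n f + f n + c   ≡⟨ xy∙z≈xz∙y (∑< n f) (f n) c ⟩
  ∑< n f + c + f n   ≤⟨ +-mono-≤ (∑<-mono-except₂ n c v≢w v<n w<n
                                   (λ x x<n → f≤g x (m<n⇒m<1+n x<n)) fvw≤gvw)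
                                 (f≤g n ≤-refl n≢v n≢w) ⟩
  ∑< n g + g n       ∎
  where
  open ≤-Reasoning
  v<n : v < n
  v<n = ≤∧≢⇒< (≤-pred v<1+n) (≢-sym n≢v)
  w<n : w < n
  w<n = ≤∧≢⇒< (≤-pred w<1+n) (≢-sym n≢w)

logSum : ℕ → ℕ
logSum zero    = 0
logSum (suc d) = logSum d + ⌊log₂ suc d ⌋

logSum-mono-≤ : ∀ {m n} → m ≤ n → logSum m ≤ logSum n
logSum-mono-≤ z≤n       = z≤n
logSum-mono-≤ (s≤s m≤n) = +-mono-≤ (logSum-mono-≤ m≤n) (⌊log₂⌋-mono-≤ (s≤s m≤n))

logSum-+-≤ : ∀ k d → logSum (k + d) ≤ logSum d + k * ⌊log₂ (k + d) ⌋
logSum-+-≤ zero    d = ≤-reflexive (sym (+-identityʳ (logSum d)))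
logSum-+-≤ (suc k) d = begin
  logSum (k + d) + ℓ                    ≤⟨ +-monoˡ-≤ ℓ (logSum-+-≤ k d) ⟩
  logSum d + k * ⌊log₂ (k + d) ⌋ + ℓ    ≤⟨ +-monoˡ-≤ ℓ (+-monoʳ-≤ (logSum d)
                                             (*-monoʳ-≤ k (⌊log₂⌋-mono-≤ (n≤1+n (k + d))))) ⟩
  logSum d + k * ℓ + ℓ                  ≡⟨ +-assoc (logSum d) (k * ℓ) ℓ ⟩
  logSum d + (k * ℓ + ℓ)                ≡⟨ cong (logSum d +_) (+-comm (k * ℓ) ℓ) ⟩
  logSum d + suc k * ℓ                  ∎
  where
  open ≤-Reasoning
  ℓ : ℕ
  ℓ = ⌊log₂ (suc k + d) ⌋

logSum-split : ∀ a b → a ≤ b → logSum a + logSum b + a ≤ logSum (a + b)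
logSum-split zero    b _   = ≤-reflexive (+-identityʳ (logSum b))
logSum-split (suc a) b a<b = begin
  logSum a + ⌊log₂ suc a ⌋ + logSum b + suc a   ≡⟨ rearrange (logSum a) ⌊log₂ suc a ⌋ (logSum b) a ⟩
  logSum a + logSum b + a + suc ⌊log₂ suc a ⌋   ≤⟨ +-mono-≤ (logSum-split a b (<⇒≤ a<b)) log-doubling ⟩
  logSum (a + b) + ⌊log₂ suc (a + b) ⌋          ∎
  where
  open ≤-Reasoning
  rearrange : ∀ p q r a → p + q + r + suc a ≡ p + r + a + suc q
  rearrange = solve-∀
  log-doubling : suc ⌊log₂ suc a ⌋ ≤ ⌊log₂ suc (a + b) ⌋
  log-doubling = begin
    suc ⌊log₂ suc a ⌋    ≡⟨ sym (⌊log₂[2*b]⌋≡1+⌊log₂b⌋ (suc a)) ⟩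
    ⌊log₂ (2 * suc a) ⌋  ≤⟨ ⌊log₂⌋-mono-≤ (+-monoʳ-≤ (suc a) (≤-trans (≤-reflexive (+-identityʳ (suc a))) a<b)) ⟩
    ⌊log₂ suc (a + b) ⌋  ∎

logSum-split-⊓ : ∀ a b → logSum a + logSum b + a ⊓ b ≤ logSum (a + b)
logSum-split-⊓ a b with ≤-total a b
... | inj₁ a≤b rewrite m≤n⇒m⊓n≡m a≤b = logSum-split a b a≤b
... | inj₂ b≤a rewrite m≥n⇒m⊓n≡n b≤a | +-comm a b | +-comm (logSum a) (logSum b) = logSum-split b a b≤a

⌊log₂[2*n]⌋≤1+⌊log₂n⌋ : ∀ n → ⌊log₂ (2 * n) ⌋ ≤ suc ⌊log₂ n ⌋
⌊log₂[2*n]⌋≤1+⌊log₂n⌋ zero    = z≤n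
⌊log₂[2*n]⌋≤1+⌊log₂n⌋ (suc n) = ≤-reflexive (⌊log₂[2*b]⌋≡1+⌊log₂b⌋ (suc n))

δ : ℕ → ℕ → ℕ
δ a x = if a ≡ᵇ x then 1 else 0

δ-refl : ∀ a → δ a a ≡ 1
δ-refl a rewrite dec-true (a ≟ a) refl = refl

δ-≢ : ∀ {a x} → a ≢ x → δ a x ≡ 0
δ-≢ {a} {x} a≢x rewrite dec-false (a ≟ x) a≢x = refl

δ≤1 : ∀ a x → δ a x ≤ 1
δ≤1 a x with a ≡ᵇ x
... | true  = ≤-refl
... | false = z≤n

∑<-δ-beyond : ∀ a n → n ≤ a → ∑[ x < n ] δ a x ≡ 0
∑<-δ-beyond a zero    _     = refl
∑<-δ-beyond a (suc n) n<a =
  cong₂ _+_ (∑<-δ-beyond a n (≤-trans (n≤1+n n) n<a)) (δ-≢ (≢-sym (<⇒≢ n<a)))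

∑<-δ≤1 : ∀ a n → ∑[ x < n ] δ a x ≤ 1
∑<-δ≤1 a zero = z≤n
∑<-δ≤1 a (suc n) with a ≟ n
... | yes refl = ≤-reflexive (cong₂ _+_ (∑<-δ-beyond a a ≤-refl) (δ-refl a))
... | no a≢n rewrite δ-≢ a≢n | +-identityʳ (∑[ x < n ] δ a x) = ∑<-δ≤1 a n

endpts≤2 : ∀ x e → endpts x e ≤ 2
endpts≤2 x (a , b) = +-mono-≤ (δ≤1 a x) (δ≤1 b x)

∑<-endpts≤2 : ∀ e n → ∑[ x < n ] endpts x e ≤ 2
∑<-endpts≤2 (a , b) n =
  ≤-trans (≤-reflexive (∑<-distrib-+ (δ a) (δ b) n)) (+-mono-≤ (∑<-δ≤1 a n) (∑<-δ≤1 b n))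

endpts-nonincident : ∀ {x} e → ¬ incident x e → endpts x e ≡ 0
endpts-nonincident (a , b) ¬inc = cong₂ _+_ (δ-≢ (¬inc ∘ inj₁)) (δ-≢ (¬inc ∘ inj₂))

deg-nonincident : ∀ {x G} → All (λ e → ¬ incident x e) G → deg x G ≡ 0
deg-nonincident []                           = refl
deg-nonincident {G = e ∷ _} (¬inc ∷ ¬incs) =
  cong₂ _+_ (endpts-nonincident e ¬inc) (deg-nonincident ¬incs)

deg≤2*length : ∀ x G → deg x G ≤ 2 * length G
deg≤2*length x []      = z≤n
deg≤2*length x (e ∷ G) =
  ≤-trans (+-mono-≤ (endpts≤2 x e) (deg≤2*length x G)) (≤-reflexive (sym (*-suc 2 (length G))))

deg-++ : ∀ x A B → deg x (A ++ B) ≡ deg x A + deg x B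
deg-++ x A B = trans (cong sum (map-++ (endpts x) A B)) (sum-++ (map (endpts x) A) (map (endpts x) B))

deg-++₃ : ∀ x A B C → deg x (A ++ B ++ C) ≡ deg x A + (deg x B + deg x C)
deg-++₃ x A B C = trans (deg-++ x A (B ++ C)) (cong (deg x A +_) (deg-++ x B C))

deg-↭ : ∀ x {G H} → G ↭ H → deg x G ≡ deg x H
deg-↭ x p = sum-↭ (map⁺ (endpts x) p)

relabel : Vertex → Vertex → Vertex → Vertex
relabel v w c = if c ≡ᵇ v then w else c

relabel-self : ∀ v w → relabel v w v ≡ w
relabel-self v w rewrite dec-true (v ≟ v) refl = refl

relabel-other : ∀ {v w c} → c ≢ v → relabel v w c ≡ c
relabel-other {v} {w} {c} c≢v rewrite dec-false (c ≟ v) c≢v = refl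

δ-relabel-old : ∀ {v v₂} → v₂ ≢ v → ∀ c → c ≢ v₂ → δ (relabel v v₂ c) v ≡ δ c v₂
δ-relabel-old {v} {v₂} v₂≢v c c≢v₂ with c ≟ v
... | yes refl rewrite relabel-self c v₂ | δ-≢ c≢v₂ = δ-≢ v₂≢v
... | no c≢v   rewrite relabel-other {w = v₂} c≢v | δ-≢ c≢v₂ = δ-≢ c≢v

δ-relabel-new : ∀ {v v₂} c → c ≢ v₂ → δ (relabel v v₂ c) v₂ ≡ δ c v
δ-relabel-new {v} {v₂} c c≢v₂ with c ≟ v
... | yes refl rewrite relabel-self c v₂ | δ-refl v₂ | δ-refl c = refl
... | no c≢v   rewrite relabel-other {w = v₂} c≢v | δ-≢ c≢v₂ | δ-≢ c≢v = refl

δ-relabel-other : ∀ {v v₂ x} c → x ≢ v → x ≢ v₂ → δ (relabel v v₂ c) x ≡ δ c x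
δ-relabel-other {v} {v₂} {x} c x≢v x≢v₂ with c ≟ v
... | yes refl rewrite relabel-self c v₂ | δ-≢ (≢-sym x≢v₂) | δ-≢ (≢-sym x≢v) = refl
... | no c≢v   rewrite relabel-other {w = v₂} c≢v = refl

deg-rename : ∀ {v v₂} x y → (∀ c → c ≢ v₂ → δ (relabel v v₂ c) x ≡ δ c y) →
             ∀ {B} → All (λ e → ¬ incident v₂ e) B → deg x (map (rename v v₂) B) ≡ deg y B
deg-rename x y coord []                             = refl
deg-rename x y coord {(a , b) ∷ _} (fresh ∷ fresh*) =
  cong₂ _+_ (cong₂ _+_ (coord a (fresh ∘ inj₁)) (coord b (fresh ∘ inj₂)))
            (deg-rename x y coord fresh*)

module SplitDegrees {G : Graph} {v v₂ : Vertex} {A B C : List Edge}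
  (v₂≢v : v₂ ≢ v) (fresh : All (λ e → ¬ incident v₂ e) G)
  (G↭ABC : G ↭ A ++ B ++ C) (¬C : All (λ e → ¬ incident v e) C) where

  G′ : Graph
  G′ = A ++ map (rename v v₂) B ++ C

  private
    freshABC : All (λ e → ¬ incident v₂ e) (A ++ B ++ C)
    freshABC = All-resp-↭ G↭ABC fresh

    freshA : All (λ e → ¬ incident v₂ e) A
    freshA = ++⁻ˡ A freshABC

    freshB : All (λ e → ¬ incident v₂ e) B
    freshB = ++⁻ˡ B (++⁻ʳ A freshABC)

    freshC : All (λ e → ¬ incident v₂ e) C
    freshC = ++⁻ʳ B (++⁻ʳ A freshABC)

    deg-G : ∀ x → deg x G ≡ deg x A + (deg x B + deg x C)
    deg-G x = trans (deg-↭ x G↭ABC) (deg-++₃ x A B C)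

  open ≡-Reasoning

  deg-other : ∀ x → x ≢ v → x ≢ v₂ → deg x G′ ≡ deg x G
  deg-other x x≢v x≢v₂ = begin
    deg x G′                                          ≡⟨ deg-++₃ x A _ C ⟩
    deg x A + (deg x (map (rename v v₂) B) + deg x C) ≡⟨ cong (λ n → deg x A + (n + deg x C))
        (deg-rename x x (λ c _ → δ-relabel-other c x≢v x≢v₂) freshB) ⟩
    deg x A + (deg x B + deg x C)                     ≡⟨ sym (deg-G x) ⟩
    deg x G                                           ∎

  deg-old-before : deg v G ≡ deg v A + deg v B
  deg-old-before = begin
    deg v G                       ≡⟨ deg-G v ⟩
    deg v A + (deg v B + deg v C) ≡⟨ cong (λ n → deg v A + (deg v B + n)) (deg-nonincident ¬C) ⟩
    deg v A + (deg v B + 0)       ≡⟨ cong (deg v A +_) (+-identityʳ (deg v B)) ⟩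
    deg v A + deg v B             ∎

  deg-old-after : deg v G′ ≡ deg v A
  deg-old-after = begin
    deg v G′                                          ≡⟨ deg-++₃ v A _ C ⟩
    deg v A + (deg v (map (rename v v₂) B) + deg v C) ≡⟨ cong₂ (λ m n → deg v A + (m + n))
        (trans (deg-rename v v₂ (δ-relabel-old v₂≢v) freshB) (deg-nonincident freshB))
        (deg-nonincident ¬C) ⟩
    deg v A + 0                                       ≡⟨ +-identityʳ (deg v A) ⟩
    deg v A                                           ∎

  deg-new-before : deg v₂ G ≡ 0
  deg-new-before = deg-nonincident fresh

  deg-new-after : deg v₂ G′ ≡ deg v B
  deg-new-after = begin
    deg v₂ G′                                            ≡⟨ deg-++₃ v₂ A _ C ⟩
    deg v₂ A + (deg v₂ (map (rename v v₂) B) + deg v₂ C) ≡⟨ cong₂ _+_ (deg-nonincident freshA)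
        (cong₂ _+_ (deg-rename v₂ v δ-relabel-new freshB) (deg-nonincident freshC)) ⟩
    deg v B + 0                                          ≡⟨ +-identityʳ (deg v B) ⟩
    deg v B                                              ∎

length-map-middle : ∀ (f : Edge → Edge) A B {C} → length (A ++ map f B ++ C) ≡ length (A ++ B ++ C)
length-map-middle f (_ ∷ A) B       = cong suc (length-map-middle f A B)
length-map-middle f []      (_ ∷ B) = cong suc (length-map-middle f [] B)
length-map-middle f []      []      = refl

Step-length : ∀ {G u G′} → Step G u G′ → length G′ ≤ suc (length G)
Step-length (ins e)   = ≤-refl
Step-length (del e p) = ≤-trans (n≤1+n _) (≤-trans (≤-reflexive (sym (↭-length p))) (n≤1+n _))
Step-length (split v v₂ A B C _ _ p _ _ _) =
  ≤-trans (≤-reflexive (trans (length-map-middle (rename v v₂) A B) (sym (↭-length p)))) (n≤1+n _)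

splitBound : Update → ℕ
splitBound (insE _)       = 0
splitBound (delE _)       = 0
splitBound (split v v₂ _) = suc (v ⊔ v₂)

maxSplitBound : List Update → ℕ
maxSplitBound = foldr (λ u V → splitBound u ⊔ V) 0

-- Vertex labels are unbounded, so Φ only sums over x < V; the vertices of
-- every split must lie below V, whereas insertions are bounded termwise.
module Amortization (T V : ℕ) where

  L : ℕ
  L = ⌊log₂ (2 * T) ⌋

  stepCost : ℕ
  stepCost = 1 + 2 * L

  Φ : Graph → ℕ
  Φ G = ∑[ x < V ] logSum (deg x G)

  Φ-ins : ∀ e G → length (e ∷ G) ≤ T → Φ (e ∷ G) ≤ Φ G + 2 * L
  Φ-ins e G len≤T = begin
    Φ (e ∷ G)                                       ≤⟨ ∑<-mono-≤ V (λ x _ → logSum-ins x) ⟩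
    ∑[ x < V ] (logSum (deg x G) + endpts x e * L) ≡⟨ ∑<-distrib-+ (λ x → logSum (deg x G)) _ V ⟩
    Φ G + ∑[ x < V ] (endpts x e * L)              ≡⟨ cong (Φ G +_) (∑<-distribʳ-* (λ x → endpts x e) L V) ⟩
    Φ G + (∑[ x < V ] endpts x e) * L              ≤⟨ +-monoʳ-≤ (Φ G) (*-monoˡ-≤ L (∑<-endpts≤2 e V)) ⟩
    Φ G + 2 * L                                     ∎
    where
    open ≤-Reasoning
    logSum-ins : ∀ x → logSum (endpts x e + deg x G) ≤ logSum (deg x G) + endpts x e * L
    logSum-ins x = ≤-trans (logSum-+-≤ (endpts x e) (deg x G))
      (+-monoʳ-≤ (logSum (deg x G)) (*-monoʳ-≤ (endpts x e)
        (⌊log₂⌋-mono-≤ (≤-trans (deg≤2*length x (e ∷ G)) (*-monoʳ-≤ 2 len≤T)))))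

  Φ-del : ∀ {e G H} → G ↭ e ∷ H → Φ H ≤ Φ G
  Φ-del {e} {G} {H} G↭eH = ∑<-mono-≤ V λ x _ →
    logSum-mono-≤ (≤-trans (m≤n+m (deg x H) (endpts x e)) (≤-reflexive (sym (deg-↭ x G↭eH))))

  Φ-split : ∀ {G v v₂ A B C} → v < V → v₂ < V → v₂ ≢ v → All (λ e → ¬ incident v₂ e) G →
            G ↭ A ++ B ++ C → All (λ e → ¬ incident v e) C →
            Φ (A ++ map (rename v v₂) B ++ C) + enc G (split v v₂ B) ≤ Φ G
  Φ-split {G} {v} {v₂} {A} {B} v<V v₂<V v₂≢v fresh G↭ABC ¬C =
    ∑<-mono-except₂ {λ x → logSum (deg x G′)} {λ x → logSum (deg x G)} V _ (≢-sym v₂≢v) v<V v₂<V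
      (λ x _ x≢v x≢v₂ → ≤-reflexive (cong logSum (deg-other x x≢v x≢v₂))) released
    where
    open SplitDegrees {A = A} {B} v₂≢v fresh G↭ABC ¬C
    released : logSum (deg v G′) + logSum (deg v₂ G′) + enc G (split v v₂ B) ≤
               logSum (deg v G) + logSum (deg v₂ G)
    released rewrite deg-old-after | deg-new-after | deg-old-before | deg-new-before
                   | m+n∸n≡m (deg v A) (deg v B) | +-identityʳ (logSum (deg v A + deg v B))
                   = logSum-split-⊓ (deg v A) (deg v B)

  Φ≤length*2L : ∀ G → length G ≤ T → Φ G ≤ length G * (2 * L)
  Φ≤length*2L []      _     = ≤-reflexive (∑<-zero V)
  Φ≤length*2L (e ∷ G) len≤T = begin
    Φ (e ∷ G)                  ≤⟨ Φ-ins e G len≤T ⟩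
    Φ G + 2 * L                ≤⟨ +-monoˡ-≤ (2 * L) (Φ≤length*2L G (≤-trans (n≤1+n _) len≤T)) ⟩
    length G * (2 * L) + 2 * L ≡⟨ +-comm (length G * (2 * L)) (2 * L) ⟩
    suc (length G) * (2 * L)   ∎
    where open ≤-Reasoning

  Φ-step : ∀ {G u G′} → Step G u G′ → splitBound u ≤ V → length G′ ≤ T →
           enc G u + Φ G′ ≤ Φ G + stepCost
  Φ-step {G} (ins e) _ len≤T = begin
    1 + Φ (e ∷ G)     ≤⟨ +-monoʳ-≤ 1 (Φ-ins e G len≤T) ⟩
    1 + (Φ G + 2 * L) ≡⟨ x∙yz≈y∙xz 1 (Φ G) (2 * L) ⟩
    Φ G + stepCost    ∎
    where open ≤-Reasoning
  Φ-step {G} (del {H = H} e G↭eH) _ _ = begin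
    1 + Φ H           ≤⟨ +-monoʳ-≤ 1 (Φ-del G↭eH) ⟩
    1 + Φ G           ≡⟨ +-comm 1 (Φ G) ⟩
    Φ G + 1           ≤⟨ +-monoʳ-≤ (Φ G) (m≤m+n 1 (2 * L)) ⟩
    Φ G + stepCost    ∎
    where open ≤-Reasoning
  Φ-step {G} (split v v₂ A B C v₂≢v fresh G↭ABC _ _ ¬C) bound≤V _ = begin
    enc G (split v v₂ B) + Φ G′ ≡⟨ +-comm (enc G (split v v₂ B)) (Φ G′) ⟩
    Φ G′ + enc G (split v v₂ B) ≤⟨ Φ-split {A = A} {B} v<V v₂<V v₂≢v fresh G↭ABC ¬C ⟩
    Φ G                         ≤⟨ m≤m+n (Φ G) stepCost ⟩
    Φ G + stepCost              ∎
    where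
    open ≤-Reasoning
    G′ : Graph
    G′ = A ++ map (rename v v₂) B ++ C
    v<V : v < V
    v<V = ≤-trans (s≤s (m≤m⊔n v v₂)) bound≤V
    v₂<V : v₂ < V
    v₂<V = ≤-trans (s≤s (m≤n⊔m v v₂)) bound≤V

  Φ-run : ∀ {G us} (r : Run G us) → maxSplitBound us ≤ V → length G + length us ≤ T →
          encRun r ≤ Φ G + length us * stepCost
  Φ-run []                               _       _     = z≤n
  Φ-run {G} {u ∷ us} (_∷_ {G' = G′} s r) bound≤V len≤T = begin
    enc G u + encRun r                      ≤⟨ +-monoʳ-≤ (enc G u)
                                                 (Φ-run r (m⊔n≤o⇒n≤o (splitBound u) _ bound≤V) len′≤T) ⟩
    enc G u + (Φ G′ + length us * stepCost) ≡⟨ sym (+-assoc (enc G u) (Φ G′) _) ⟩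
    enc G u + Φ G′ + length us * stepCost   ≤⟨ +-monoˡ-≤ _ (Φ-step s (m⊔n≤o⇒m≤o (splitBound u) _ bound≤V)
                                                                (≤-trans (m≤m+n _ _) len′≤T)) ⟩
    Φ G + stepCost + length us * stepCost   ≡⟨ +-assoc (Φ G) stepCost _ ⟩
    Φ G + suc (length us) * stepCost        ∎
    where
    open ≤-Reasoning
    len′≤T : length G′ + length us ≤ T
    len′≤T = ≤-trans (+-monoˡ-≤ (length us) (Step-length s))
                     (≤-trans (≤-reflexive (sym (+-suc (length G) (length us)))) len≤T)

  stepCost≤3*[1+⌊log₂T⌋] : stepCost ≤ 3 * suc ⌊log₂ T ⌋
  stepCost≤3*[1+⌊log₂T⌋] =
    ≤-trans (+-monoʳ-≤ 1 (*-monoʳ-≤ 2 (⌊log₂[2*n]⌋≤1+⌊log₂n⌋ T))) (+-monoˡ-≤ (2 * suc ⌊log₂ T ⌋) (s≤s z≤n))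

encRun≤3*n*[1+⌊log₂n⌋] : ∀ {G us} (r : Run G us) →
  encRun r ≤ 3 * (length G + length us) * suc ⌊log₂ (length G + length us) ⌋
encRun≤3*n*[1+⌊log₂n⌋] {G} {us} r = begin
  encRun r                                   ≤⟨ Φ-run r ≤-refl ≤-refl ⟩
  Φ G + length us * stepCost                 ≤⟨ +-monoˡ-≤ _ (≤-trans (Φ≤length*2L G (m≤m+n _ _))
                                                                    (*-monoʳ-≤ (length G) (n≤1+n _))) ⟩
  length G * stepCost + length us * stepCost ≡⟨ sym (*-distribʳ-+ stepCost (length G) (length us)) ⟩
  T * stepCost                               ≤⟨ *-monoʳ-≤ T stepCost≤3*[1+⌊log₂T⌋] ⟩
  T * (3 * suc ⌊log₂ T ⌋)                    ≡⟨ reorder T (suc ⌊log₂ T ⌋) ⟩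
  3 * T * suc ⌊log₂ T ⌋                      ∎
  where
  T : ℕ
  T = length G + length us
  open Amortization T (maxSplitBound us)
  open ≤-Reasoning
  reorder : ∀ t l → t * (3 * l) ≡ 3 * t * l
  reorder = solve-∀

length-concat : ∀ (Us : Batches) → length (concat Us) ≡ totalUpdates Us
length-concat []       = refl
length-concat (U ∷ Us) = trans (length-++ U) (cong (length U +_) (length-concat Us))

lemma2p1 : Σ ℕ λ c → Σ ℕ λ k →
    (G : Graph) (Us : Batches) (r : Run G (concat Us)) →
      encRun r ≤ c * (numEdges G + totalUpdates Us)
                   * suc ⌊log₂ (numEdges G + totalUpdates Us) ⌋ ^ k
lemma2p1 = 3 , 1 , λ G Us r → begin
  encRun r
    ≤⟨ encRun≤3*n*[1+⌊log₂n⌋] r ⟩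
  3 * (length G + length (concat Us)) * suc ⌊log₂ (length G + length (concat Us)) ⌋
    ≡⟨ cong (λ n → 3 * (length G + n) * suc ⌊log₂ (length G + n) ⌋) (length-concat Us) ⟩
  3 * (numEdges G + totalUpdates Us) * suc ⌊log₂ (numEdges G + totalUpdates Us) ⌋
    ≡⟨ cong (3 * (numEdges G + totalUpdates Us) *_) (sym (*-identityʳ _)) ⟩
  3 * (numEdges G + totalUpdates Us) * suc ⌊log₂ (numEdges G + totalUpdates Us) ⌋ ^ 1 ∎
  where open ≤-Reasoning
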